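{- Let $b\ge 2$, $m\ge1$ be integers with $m\nmid(b-1)$, $\Sigma$ an alphabet with $m$ letters, $\sigma$ a cyclic permutation of $\Sigma$ (a single $m$-cycle), $\overline{\alpha}\in\Sigma$, and $\mathbf{t}$ the corresponding generalized Thue–Morse word. Let $w$ be a critical factor of $\mathbf{t}$ of length $\ell$. Then (i) $\mu(w)$ is a critical factor of $\mathbf{t}$; (ii) if $b\mid\ell$, then $w=\mu(u)$ for a (unique) word $u$, and $u=\mu^{ -1}(w)$ is a critical factor of $\mathbf{t}$.
   Context: $\mu:\Sigma^*\to\Sigma^*$ is the morphism $\mu(\alpha)=\alpha\,\sigma(\alpha)\cdots\sigma^{b-1}(\alpha)$ and $\mathbf{t}=\lim_n\mu^n(\overline{\alpha})$. For a nonempty word $w$ and rational $r>0$ with $r|w|\in\mathbb N$, $w^r=w^{\lfloor r\rfloor}p$ with $p$ the prefix of $w$ of length $(r-\lfloor r\rfloor)|w|$; $\textsc{Index}(w)=\max\{r\in\mathbb Q: w^r\text{ factor of }\mathbf{t}\}$; $E(\mathbf{t})=\sup\textsc{Index}(w)$ over nonempty factors; a critical factor is a nonempty factor $w$ with $\textsc{Index}(w)=E(\mathbf{t})$. -}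

module Defs where

open import Data.Nat using (ℕ; zero; suc; _+_; _*_; _^_; _≤_; _<_)
open import Data.Fin using (Fin)
open import Data.List using (List; []; _∷_; _++_; map; upTo; length; applyUpTo; take; concat; replicate)
open import Data.Product using (Σ; ∃; _×_; _,_)
open import Relation.Binary.PropositionalEquality using (_≡_)
open import Function.Definitions using (Injective)

iter : {A : Set} → (A → A) → ℕ → A → A
iter f zero    x = x
iter f (suc k) x = f (iter f k x)

-- σ is a cyclic permutation of Fin m consisting of a single m-cycle:
-- a bijection (injective, and the orbit of every letter is everything)
IsCyclicPerm : {m : ℕ} → (Fin m → Fin m) → Set
IsCyclicPerm {m} σ = Injective _≡_ _≡_ σ × (∀ x y → ∃ λ k → iter σ k x ≡ y)

Word : ℕ → Set
Word m = List (Fin m)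

μ : {m : ℕ} → ℕ → (Fin m → Fin m) → Word m → Word m
μ b σ []      = []
μ b σ (a ∷ w) = map (λ j → iter σ j a) (upTo b) ++ μ b σ w

μ^ : {m : ℕ} → ℕ → (Fin m → Fin m) → ℕ → Word m → Word m
μ^ b σ n = iter (μ b σ) n

nth : {A : Set} → A → List A → ℕ → A
nth d []      i       = d
nth d (x ∷ w) zero    = x
nth d (x ∷ w) (suc i) = nth d w i

-- t = lim_n μ^n(ᾱ): its i-th letter is the i-th letter of μ^{i+1}(ᾱ),
-- which has length b^{i+1} > i when b ≥ 2 (so the default is never used).
tm : {m : ℕ} → ℕ → (Fin m → Fin m) → Fin m → ℕ → Fin m
tm b σ ᾱ i = nth ᾱ (μ^ b σ (suc i) (ᾱ ∷ [])) i

window : {m : ℕ} → (ℕ → Fin m) → ℕ → ℕ → Word m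
window t i n = applyUpTo (λ j → t (i + j)) n

Factor : {m : ℕ} → (ℕ → Fin m) → Word m → Set
Factor t w = ∃ λ i → w ≡ window t i (length w)

NonEmpty : {A : Set} → List A → Set
NonEmpty w = 1 ≤ length w

-- the fractional power w^r with r = n / |w| (so r|w| = n ∈ ℕ):
-- w^⌊r⌋ followed by the prefix of w of length n - ⌊r⌋|w|,
-- i.e. the prefix of length n of w w w ...
pow : {A : Set} → List A → ℕ → List A
pow w n = take n (concat (replicate n w))

PowFactor : {m : ℕ} → (ℕ → Fin m) → Word m → ℕ → Set
PowFactor t w n = 1 ≤ n × Factor t (pow w n)

IsIndex : {m : ℕ} → (ℕ → Fin m) → Word m → ℕ → Set
IsIndex t w n = PowFactor t w n × (∀ k → PowFactor t w k → k ≤ n)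

-- w is a critical factor: a nonempty factor with Index(w) = E(t) = sup of
-- Index(v) over nonempty factors v; i.e. Index(w) = n/|w| and for every
-- nonempty factor v and every power v^(k/|v|) occurring in t, k/|v| ≤ n/|w|.
IsCritical : {m : ℕ} → (ℕ → Fin m) → Word m → Set
IsCritical t w = NonEmpty w × Factor t w ×
  (∃ λ n → IsIndex t w n ×
     (∀ v k → NonEmpty v → Factor t v → PowFactor t v k → k * length w ≤ n * length v))

-- μ multiplies lengths by b and sends an occurrence of v^(k/|v|) at position p to an
-- occurrence of μ(v)^(bk/b|v|) at position bp, so it preserves exponents; this gives (i).
-- For (ii), let w^(n/ℓ) occur at p with b ∣ ℓ, and note ℓ < n because t[1, b) has
-- exponent b/(b-1) > 1. Within a μ-block consecutive letters differ by σ, so for a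
-- period that is a multiple of b the equation t(x + ℓ) = t(x) at one offset of a block
-- is equivalent (σ being injective) to the equation at the next offset. Hence if
-- p ≢ 0 (mod b) the occurrence of the period-ℓ factor extends one letter to the left,
-- giving a factor of exponent (n+1)/ℓ against criticality, and if n ≢ 0 (mod b) it
-- extends one letter to the right, against the maximality of n. So p = bq and n = bn₁,
-- and the occurrence is the μ-image of an occurrence of u^(n₁/|u|), u = t[q, q + ℓ/b).
module Submission where

open import Defs
open import Data.Nat
open import Data.Nat.Properties
open import Algebra.Properties.CommutativeSemigroup *-commutativeSemigroup using (x∙yz≈y∙xz)
open import Data.Nat.DivMod using (_/_; _%_; m≡m%n+[m/n]*n; m%n<n)
open import Data.Nat.Divisibility using (_∣_; divides)
open import Data.Nat.Tactic.RingSolver using (solve)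
open import Data.Fin using (Fin)
open import Data.List using (List; []; _∷_; _++_; map; upTo; length; applyUpTo; take; concat; replicate)
open import Data.List.Properties
  using (length-++; length-map; length-upTo; length-applyUpTo; length-take; map-upTo;
         ++-assoc; ++-identityʳ; ++-cancelˡ; ∷-injectiveˡ)
open import Data.Product using (Σ; ∃; _×_; _,_)
open import Data.Sum using (inj₁; inj₂)
open import Data.Empty using (⊥-elim)
open import Function using (_∘_)
open import Function.Definitions using (Injective)
open import Relation.Binary.PropositionalEquality
open import Relation.Nullary using (¬_)

b*q+j<b*L : ∀ b {q L j} → q < L → j < b → b * q + j < b * L
b*q+j<b*L b {q} {L} {j} q<L j<b = begin-strict
  b * q + j   <⟨ +-monoʳ-< (b * q) j<b ⟩
  b * q + b   ≡⟨ solve (b ∷ q ∷ []) ⟩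
  b * suc q   ≤⟨ *-monoʳ-≤ b q<L ⟩
  b * L       ∎
  where open ≤-Reasoning

b*q+j<b*L⇒q<L : ∀ b {q L j} → b * q + j < b * L → q < L
b*q+j<b*L⇒q<L b {q} {L} {j} lt = *-cancelˡ-< b q L (≤-<-trans (m≤m+n (b * q) j) lt)

1≤m*n⇒1≤n : ∀ m {n} → 1 ≤ m * n → 1 ≤ n
1≤m*n⇒1≤n m {zero}  h = ⊥-elim (1+n≰n (subst (1 ≤_) (*-zeroʳ m) h))
1≤m*n⇒1≤n m {suc n} _ = s≤s z≤n

data Offset (ℓ : ℕ) : ℕ → Set where
  inside : ∀ {j} → j < ℓ → Offset ℓ j
  beyond : ∀ k → Offset ℓ (ℓ + k)

offset : ∀ ℓ j → Offset ℓ j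
offset zero    j       = beyond j
offset (suc ℓ) zero    = inside (s≤s z≤n)
offset (suc ℓ) (suc j) with offset ℓ j
... | inside j<ℓ = inside (s≤s j<ℓ)
... | beyond k   = beyond k

data BlockPosition (b : ℕ) : ℕ → Set where
  at : ∀ q j → j < b → BlockPosition b (b * q + j)

blockPosition : ∀ b .{{_ : NonZero b}} x → BlockPosition b x
blockPosition b x = subst (BlockPosition b) x≡ (at (x / b) (x % b) (m%n<n x b))
  where
  x≡ : b * (x / b) + x % b ≡ x
  x≡ = sym (trans (m≡m%n+[m/n]*n x b) (trans (+-comm (x % b) _) (cong (_+ x % b) (*-comm (x / b) b))))

module _ {A : Set} where

  concat-replicate-suc : ∀ N (w : List A) → concat (replicate (suc N) w) ≡ concat (replicate N w) ++ w
  concat-replicate-suc zero    w = ++-identityʳ w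
  concat-replicate-suc (suc N) w =
    trans (cong (w ++_) (concat-replicate-suc N w)) (sym (++-assoc w (concat (replicate N w)) w))

  length-concat-replicate : ∀ N (w : List A) → length (concat (replicate N w)) ≡ N * length w
  length-concat-replicate zero    w = refl
  length-concat-replicate (suc N) w = trans (length-++ w) (cong (length w +_) (length-concat-replicate N w))

  length-pow : ∀ (w : List A) n → 1 ≤ length w → length (pow w n) ≡ n
  length-pow w n 1≤ℓ = trans (length-take n _) (m≤n⇒m⊓n≡m (begin
    n                                   ≤⟨ m≤m*n n (length w) {{>-nonZero 1≤ℓ}} ⟩
    n * length w                        ≡⟨ sym (length-concat-replicate n w) ⟩
    length (concat (replicate n w))     ∎))
    where open ≤-Reasoning

module _ {A : Set} (d : A) where

  nth-ext : (xs ys : List A) → length xs ≡ length ys →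
            (∀ j → j < length xs → nth d xs j ≡ nth d ys j) → xs ≡ ys
  nth-ext []       []       _  _ = refl
  nth-ext (x ∷ xs) (y ∷ ys) eq f =
    cong₂ _∷_ (f 0 (s≤s z≤n)) (nth-ext xs ys (suc-injective eq) (λ j j< → f (suc j) (s≤s j<)))

  nth-++ˡ : (xs ys : List A) → ∀ {j} → j < length xs → nth d (xs ++ ys) j ≡ nth d xs j
  nth-++ˡ (x ∷ xs) ys {zero}  _        = refl
  nth-++ˡ (x ∷ xs) ys {suc j} (s≤s j<) = nth-++ˡ xs ys j<

  nth-++ʳ : (xs ys : List A) → ∀ j → nth d (xs ++ ys) (length xs + j) ≡ nth d ys j
  nth-++ʳ []       ys j = refl
  nth-++ʳ (x ∷ xs) ys j = nth-++ʳ xs ys j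

  nth-take : ∀ n (xs : List A) {j} → j < n → nth d (take n xs) j ≡ nth d xs j
  nth-take (suc n) []       _                = refl
  nth-take (suc n) (x ∷ xs) {zero}  _        = refl
  nth-take (suc n) (x ∷ xs) {suc j} (s≤s j<) = nth-take n xs j<

  nth-applyUpTo : (f : ℕ → A) → ∀ n {j} → j < n → nth d (applyUpTo f n) j ≡ f j
  nth-applyUpTo f (suc n) {zero}  _        = refl
  nth-applyUpTo f (suc n) {suc j} (s≤s j<) = nth-applyUpTo (f ∘ suc) n j<

  nth-concat-replicate-head : ∀ N (w : List A) {j} → j < length w → 0 < N →
                              nth d (concat (replicate N w)) j ≡ nth d w j
  nth-concat-replicate-head (suc N) w j<ℓ _ = nth-++ˡ w _ j<ℓ

  nth-concat-replicate-periodic : ∀ N (w : List A) {j} → j + length w < N * length w →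
    nth d (concat (replicate N w)) (j + length w) ≡ nth d (concat (replicate N w)) j
  nth-concat-replicate-periodic (suc N) w {j} lt = begin
    nth d (w ++ wᴺ) (j + ℓ)     ≡⟨ cong (nth d (w ++ wᴺ)) (+-comm j ℓ) ⟩
    nth d (w ++ wᴺ) (ℓ + j)     ≡⟨ nth-++ʳ w wᴺ j ⟩
    nth d wᴺ j                  ≡⟨ sym (nth-++ˡ wᴺ w j<Nℓ) ⟩
    nth d (wᴺ ++ w) j           ≡⟨ cong (λ xs → nth d xs j) (sym (concat-replicate-suc N w)) ⟩
    nth d (w ++ wᴺ) j           ∎
    where
    open ≡-Reasoning
    ℓ : ℕ
    ℓ = length w
    wᴺ : List A
    wᴺ = concat (replicate N w)
    j<Nℓ : j < length wᴺ
    j<Nℓ = subst (j <_) (sym (length-concat-replicate N w))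
             (+-cancelˡ-< ℓ j (N * ℓ) (subst (_< ℓ + N * ℓ) (+-comm j ℓ) lt))

module Occurrences {m : ℕ} (t : ℕ → Fin m) where

  Periodic : ℕ → ℕ → ℕ → Set
  Periodic p ℓ n = ∀ j → j + ℓ < n → t (p + j + ℓ) ≡ t (p + j)

  -- The prefix of length n of w w w ⋯ occurs in t at position p.
  record PowerAt (w : Word m) (p n : ℕ) : Set where
    field
      agrees   : ∀ {j} → j < n → j < length w → nth (t 0) w j ≡ t (p + j)
      periodic : Periodic p (length w) n
  open PowerAt public

  length-window : ∀ p ℓ → length (window t p ℓ) ≡ ℓ
  length-window p = length-applyUpTo _

  nth-window : ∀ p ℓ {j} → j < ℓ → nth (t 0) (window t p ℓ) j ≡ t (p + j)
  nth-window p ℓ = nth-applyUpTo (t 0) _ ℓ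

  window-factor : ∀ p ℓ → Factor t (window t p ℓ)
  window-factor p ℓ = p , cong (window t p) (sym (length-window p ℓ))

  periodic⇒powerAt : ∀ {p ℓ n} → Periodic p ℓ n → PowerAt (window t p ℓ) p n
  agrees   (periodic⇒powerAt {p} {ℓ} _) _ j<ℓ = nth-window p ℓ (subst (_ <_) (length-window p ℓ) j<ℓ)
  periodic (periodic⇒powerAt {p} {ℓ} {n} per) = subst (λ L → Periodic p L n) (sym (length-window p ℓ)) per

  powerAt⇒window : ∀ {w p n} → length w ≤ n → PowerAt w p n → w ≡ window t p (length w)
  powerAt⇒window {w} {p} ℓ≤n pw = nth-ext (t 0) _ _ (sym (length-window p _)) λ j j<ℓ →
    trans (agrees pw (<-≤-trans j<ℓ ℓ≤n) j<ℓ) (sym (nth-window p _ j<ℓ))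

  nth-concat-replicate-powerAt : ∀ {w p n} → PowerAt w p n → ∀ N {j} → j < N * length w → j < n →
                                 nth (t 0) (concat (replicate N w)) j ≡ t (p + j)
  nth-concat-replicate-powerAt {w} {p} {n} pw (suc N) {j} j< j<n with offset (length w) j
  ... | inside j<ℓ = trans (nth-++ˡ (t 0) w _ j<ℓ) (agrees pw j<n j<ℓ)
  ... | beyond k   = begin
    nth (t 0) (w ++ wᴺ) (ℓ + k)   ≡⟨ nth-++ʳ (t 0) w wᴺ k ⟩
    nth (t 0) wᴺ k                ≡⟨ nth-concat-replicate-powerAt pw N (+-cancelˡ-< ℓ k (N * ℓ) j<) k<n ⟩
    t (p + k)                     ≡⟨ sym (periodic pw k (subst (_< n) (+-comm ℓ k) j<n)) ⟩
    t (p + k + ℓ)                 ≡⟨ cong t (trans (+-assoc p k ℓ) (cong (p +_) (+-comm k ℓ))) ⟩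
    t (p + (ℓ + k))               ∎
    where
    open ≡-Reasoning
    ℓ : ℕ
    ℓ = length w
    wᴺ : Word m
    wᴺ = concat (replicate N w)
    k<n : k < n
    k<n = ≤-<-trans (m≤n+m k ℓ) j<n

  powerAt⇒powFactor : ∀ {w p n} → NonEmpty w → 1 ≤ n → PowerAt w p n → PowFactor t w n
  powerAt⇒powFactor {w} {p} {n} nw 1≤n pw =
    1≤n , p , trans pow≡window (cong (window t p) (sym (length-pow w n nw)))
    where
    n≤nℓ : n ≤ n * length w
    n≤nℓ = m≤m*n n (length w) {{>-nonZero nw}}
    pow≡window : pow w n ≡ window t p n
    pow≡window = nth-ext (t 0) _ _ (trans (length-pow w n nw) (sym (length-window p n))) λ j j< →
      let j<n = subst (j <_) (length-pow w n nw) j< in begin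
        nth (t 0) (pow w n) j                      ≡⟨ nth-take (t 0) n _ j<n ⟩
        nth (t 0) (concat (replicate n w)) j       ≡⟨ nth-concat-replicate-powerAt pw n (<-≤-trans j<n n≤nℓ) j<n ⟩
        t (p + j)                                  ≡⟨ sym (nth-window p n j<n) ⟩
        nth (t 0) (window t p n) j                 ∎
      where open ≡-Reasoning

  powFactor⇒powerAt : ∀ {w n} → NonEmpty w → PowFactor t w n → ∃ λ p → PowerAt w p n
  powFactor⇒powerAt {w} {n} nw (_ , p , eq) = p , record { agrees = agrees′ ; periodic = periodic′ }
    where
    ℓ : ℕ
    ℓ = length w
    wⁿ : Word m
    wⁿ = concat (replicate n w)
    pow≡window : pow w n ≡ window t p n
    pow≡window = trans eq (cong (window t p) (length-pow w n nw))
    t≡nth : ∀ {j} → j < n → t (p + j) ≡ nth (t 0) wⁿ j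
    t≡nth {j} j<n = begin
      t (p + j)                    ≡⟨ sym (nth-window p n j<n) ⟩
      nth (t 0) (window t p n) j   ≡⟨ cong (λ xs → nth (t 0) xs j) (sym pow≡window) ⟩
      nth (t 0) (pow w n) j        ≡⟨ nth-take (t 0) n wⁿ j<n ⟩
      nth (t 0) wⁿ j               ∎
      where open ≡-Reasoning
    agrees′ : ∀ {j} → j < n → j < ℓ → nth (t 0) w j ≡ t (p + j)
    agrees′ j<n j<ℓ = trans (sym (nth-concat-replicate-head (t 0) n w j<ℓ (m<n⇒0<n j<n))) (sym (t≡nth j<n))
    n≤nℓ : n ≤ n * ℓ
    n≤nℓ = m≤m*n n ℓ {{>-nonZero nw}}
    periodic′ : Periodic p ℓ n
    periodic′ j lt = begin
      t (p + j + ℓ)      ≡⟨ cong t (+-assoc p j ℓ) ⟩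
      t (p + (j + ℓ))    ≡⟨ t≡nth lt ⟩
      nth (t 0) wⁿ (j + ℓ) ≡⟨ nth-concat-replicate-periodic (t 0) n w (<-≤-trans lt n≤nℓ) ⟩
      nth (t 0) wⁿ j     ≡⟨ sym (t≡nth (≤-<-trans (m≤m+n j ℓ) lt)) ⟩
      t (p + j)          ∎
      where open ≡-Reasoning

  powerAt-extend : ∀ {w p n} j → j + length w ≡ n → t (p + j + length w) ≡ t (p + j) →
                   PowerAt w p n → PowerAt w p (suc n)
  powerAt-extend {w} {p} {n} j j+ℓ≡n edge pw = record
    { agrees   = λ _ j<ℓ → agrees pw (<-≤-trans j<ℓ ℓ≤n) j<ℓ
    ; periodic = periodic′ }
    where
    ℓ≤n : length w ≤ n
    ℓ≤n = subst (length w ≤_) j+ℓ≡n (m≤n+m (length w) j)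
    periodic′ : Periodic p (length w) (suc n)
    periodic′ i i+ℓ<1+n with m<1+n⇒m<n∨m≡n i+ℓ<1+n
    ... | inj₁ i+ℓ<n = periodic pw i i+ℓ<n
    ... | inj₂ i+ℓ≡n rewrite +-cancelʳ-≡ (length w) i j (trans i+ℓ≡n (sym j+ℓ≡n)) = edge

  periodic-extendˡ : ∀ {p ℓ n} → t (p + ℓ) ≡ t p → Periodic (suc p) ℓ n → Periodic p ℓ (suc n)
  periodic-extendˡ {p} {ℓ} edge per zero    _        =
    subst (λ x → t (x + ℓ) ≡ t x) (sym (+-identityʳ p)) edge
  periodic-extendˡ {p} {ℓ} edge per (suc j) (s≤s lt) =
    subst (λ x → t (x + ℓ) ≡ t x) (sym (+-suc p j)) (per j lt)

  ExponentBound : Word m → ℕ → Set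
  ExponentBound w n = ∀ v k → NonEmpty v → Factor t v → PowFactor t v k → k * length w ≤ n * length v

  exponentBound⇒≤ : ∀ {w n v k} → ExponentBound w n → NonEmpty v → Factor t v →
                    length v ≡ length w → PowFactor t v k → k ≤ n
  exponentBound⇒≤ {w} {n} {v} {k} bound nv fv v≡w pv =
    *-cancelʳ-≤ k n (length w) {{>-nonZero (subst (1 ≤_) v≡w nv)}}
      (subst (λ L → k * length w ≤ n * L) v≡w (bound v k nv fv pv))

  exponentBound-scaleUp : ∀ c {w w′ n} → length w′ ≡ c * length w →
                          ExponentBound w n → ExponentBound w′ (c * n)
  exponentBound-scaleUp c {w} {w′} {n} eq bound v k nv fv pv = begin
    k * length w′          ≡⟨ cong (k *_) eq ⟩
    k * (c * length w)     ≡⟨ x∙yz≈y∙xz k c (length w) ⟩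
    c * (k * length w)     ≤⟨ *-monoʳ-≤ c (bound v k nv fv pv) ⟩
    c * (n * length v)     ≡⟨ sym (*-assoc c n (length v)) ⟩
    c * n * length v       ∎
    where open ≤-Reasoning

  exponentBound-scaleDown : ∀ c .{{_ : NonZero c}} {w w′ n} → length w′ ≡ c * length w →
                            ExponentBound w′ (c * n) → ExponentBound w n
  exponentBound-scaleDown c {w} {w′} {n} eq bound v k nv fv pv = *-cancelˡ-≤ c (begin
    c * (k * length w)     ≡⟨ x∙yz≈y∙xz c k (length w) ⟩
    k * (c * length w)     ≡⟨ cong (k *_) (sym eq) ⟩
    k * length w′          ≤⟨ bound v k nv fv pv ⟩
    c * n * length v       ≡⟨ *-assoc c n (length v) ⟩
    c * (n * length v)     ∎)
    where open ≤-Reasoning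

  critical : ∀ {w n} → NonEmpty w → Factor t w → PowFactor t w n → ExponentBound w n → IsCritical t w
  critical {w} nw fw pw bound = nw , fw , _ , (pw , λ k → exponentBound⇒≤ {w} bound nw fw refl) , bound

upTo-head : ∀ {n} → 0 < n → ∃ λ r → upTo n ≡ 0 ∷ r
upTo-head {suc n} _ = applyUpTo suc n , refl

module Morphism {m : ℕ} (b : ℕ) (σ : Fin m → Fin m) where

  block : Fin m → Word m
  block a = map (λ j → iter σ j a) (upTo b)

  length-block : ∀ a → length (block a) ≡ b
  length-block a = trans (length-map _ (upTo b)) (length-upTo b)

  block-head : 0 < b → ∀ a → ∃ λ r → block a ≡ a ∷ r
  block-head 0<b a = let (r , upTo≡) = upTo-head 0<b in _ , cong (map (λ j → iter σ j a)) upTo≡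

  μ-++ : ∀ xs ys → μ b σ (xs ++ ys) ≡ μ b σ xs ++ μ b σ ys
  μ-++ []       ys = refl
  μ-++ (a ∷ xs) ys = trans (cong (block a ++_) (μ-++ xs ys)) (sym (++-assoc (block a) (μ b σ xs) (μ b σ ys)))

  length-μ : ∀ w → length (μ b σ w) ≡ b * length w
  length-μ []      = sym (*-zeroʳ b)
  length-μ (a ∷ w) = begin
    length (block a ++ μ b σ w)          ≡⟨ length-++ (block a) ⟩
    length (block a) + length (μ b σ w)  ≡⟨ cong₂ _+_ (length-block a) (length-μ w) ⟩
    b + b * length w                     ≡⟨ sym (*-suc b (length w)) ⟩
    b * suc (length w)                   ∎
    where open ≡-Reasoning

  nth-μ : ∀ d w {q j} → q < length w → j < b → nth d (μ b σ w) (b * q + j) ≡ iter σ j (nth d w q)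
  nth-μ d (a ∷ w) {zero} {j} _ j<b = begin
    nth d (block a ++ μ b σ w) (b * 0 + j)   ≡⟨ cong (λ x → nth d (block a ++ μ b σ w) (x + j)) (*-zeroʳ b) ⟩
    nth d (block a ++ μ b σ w) j             ≡⟨ nth-++ˡ d (block a) _ j<block ⟩
    nth d (block a) j                        ≡⟨ cong (λ xs → nth d xs j) (map-upTo _ b) ⟩
    nth d (applyUpTo (λ i → iter σ i a) b) j ≡⟨ nth-applyUpTo d _ b j<b ⟩
    iter σ j a                               ∎
    where
    open ≡-Reasoning
    j<block : j < length (block a)
    j<block = subst (j <_) (sym (length-block a)) j<b
  nth-μ d (a ∷ w) {suc q} {j} (s≤s q<) j<b = begin
    nth d (block a ++ μ b σ w) (b * suc q + j)              ≡⟨ cong (nth d (block a ++ μ b σ w)) index≡ ⟩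
    nth d (block a ++ μ b σ w) (length (block a) + (b * q + j)) ≡⟨ nth-++ʳ d (block a) _ (b * q + j) ⟩
    nth d (μ b σ w) (b * q + j)                             ≡⟨ nth-μ d w q< j<b ⟩
    iter σ j (nth d w q)                                    ∎
    where
    open ≡-Reasoning
    index≡ : b * suc q + j ≡ length (block a) + (b * q + j)
    index≡ = begin
      b * suc q + j                 ≡⟨ cong (_+ j) (*-suc b q) ⟩
      b + b * q + j                 ≡⟨ +-assoc b (b * q) j ⟩
      b + (b * q + j)               ≡⟨ cong (_+ (b * q + j)) (sym (length-block a)) ⟩
      length (block a) + (b * q + j) ∎

  μ-injective : 0 < b → ∀ {x y} → μ b σ x ≡ μ b σ y → x ≡ y
  μ-injective 0<b {[]}    {[]}     _  = refl
  μ-injective 0<b {[]}    {a ∷ y}  eq with block-head 0<b a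
  ... | _ , block≡ with trans eq (cong (_++ μ b σ y) block≡)
  ... | ()
  μ-injective 0<b {a ∷ x} {[]}     eq with block-head 0<b a
  ... | _ , block≡ with trans (sym eq) (cong (_++ μ b σ x) block≡)
  ... | ()
  μ-injective 0<b {a ∷ x} {a′ ∷ y} eq with block-head 0<b a | block-head 0<b a′
  ... | _ , block≡ | _ , block′≡
    with ∷-injectiveˡ (trans (sym (cong (_++ μ b σ x) block≡)) (trans eq (cong (_++ μ b σ y) block′≡)))
  ... | refl = cong (a ∷_) (μ-injective 0<b (++-cancelˡ (block a) (μ b σ x) (μ b σ y) eq))

module ThueMorse (b : ℕ) (2≤b : 2 ≤ b) {m : ℕ} (σ : Fin m → Fin m) (ᾱ : Fin m) where
  open Morphism b σ public

  0<b : 0 < b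
  0<b = ≤-trans (s≤s z≤n) 2≤b

  instance
    b-nonZero : NonZero b
    b-nonZero = >-nonZero 0<b

  t : ℕ → Fin m
  t = tm b σ ᾱ

  open Occurrences t

  T : ℕ → Word m
  T N = μ^ b σ N (ᾱ ∷ [])

  T-prefix-step : ∀ N → ∃ λ r → T (suc N) ≡ T N ++ r
  T-prefix-step zero    = let (r , block≡) = block-head 0<b ᾱ in r ++ [] , cong (_++ []) block≡
  T-prefix-step (suc N) =
    let (r , T≡) = T-prefix-step N in μ b σ r , trans (cong (μ b σ) T≡) (μ-++ (T N) r)

  T-prefix : ∀ k N → ∃ λ r → T (k + N) ≡ T N ++ r
  T-prefix zero    N = [] , sym (++-identityʳ (T N))
  T-prefix (suc k) N =
    let (r , T≡) = T-prefix k N ; (r′ , T′≡) = T-prefix-step (k + N) in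
    r ++ r′ , trans T′≡ (trans (cong (_++ r′) T≡) (++-assoc (T N) r r′))

  N<length-T : ∀ N → N < length (T N)
  N<length-T zero    = s≤s z≤n
  N<length-T (suc N) = begin-strict
    suc N              ≤⟨ N<length-T N ⟩
    L                  <⟨ m<m+n L (m<n⇒0<n (N<length-T N)) ⟩
    L + L              ≡⟨ cong (L +_) (sym (+-identityʳ L)) ⟩
    2 * L              ≤⟨ *-monoˡ-≤ L 2≤b ⟩
    b * L              ≡⟨ sym (length-μ (T N)) ⟩
    length (T (suc N)) ∎
    where
    open ≤-Reasoning
    L : ℕ
    L = length (T N)

  t≡nth-T : ∀ N {i} → i < length (T N) → t i ≡ nth ᾱ (T N) i
  t≡nth-T N {i} i< =
    let (r , T≡) = T-prefix (suc i) N ; (r′ , T′≡) = T-prefix N (suc i) in begin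
      nth ᾱ (T (suc i)) i        ≡⟨ sym (nth-++ˡ ᾱ (T (suc i)) r′ (<⇒≤ (N<length-T (suc i)))) ⟩
      nth ᾱ (T (suc i) ++ r′) i  ≡⟨ cong (λ xs → nth ᾱ xs i) (sym T′≡) ⟩
      nth ᾱ (T (N + suc i)) i    ≡⟨ cong (λ M → nth ᾱ (T M) i) (+-comm N (suc i)) ⟩
      nth ᾱ (T (suc i + N)) i    ≡⟨ cong (λ xs → nth ᾱ xs i) T≡ ⟩
      nth ᾱ (T N ++ r) i         ≡⟨ nth-++ˡ ᾱ (T N) r i< ⟩
      nth ᾱ (T N) i              ∎
    where open ≡-Reasoning

  t-block : ∀ q {j} → j < b → t (b * q + j) ≡ iter σ j (t q)
  t-block q {j} j<b = begin
    t (b * q + j)                         ≡⟨ t≡nth-T (suc (suc q)) index< ⟩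
    nth ᾱ (μ b σ (T (suc q))) (b * q + j) ≡⟨ nth-μ ᾱ (T (suc q)) q<T j<b ⟩
    iter σ j (nth ᾱ (T (suc q)) q)        ≡⟨ cong (iter σ j) (sym (t≡nth-T (suc q) q<T)) ⟩
    iter σ j (t q)                        ∎
    where
    open ≡-Reasoning
    q<T : q < length (T (suc q))
    q<T = <⇒≤ (N<length-T (suc q))
    index< : b * q + j < length (T (suc (suc q)))
    index< = subst (b * q + j <_) (sym (length-μ (T (suc q)))) (b*q+j<b*L b q<T j<b)

  t-step : ∀ X {s} → suc s < b → t (b * X + suc s) ≡ σ (t (b * X + s))
  t-step X {s} 1+s<b = trans (t-block X 1+s<b) (cong σ (sym (t-block X (<-trans (n<1+n s) 1+s<b))))

  t-aligned : ∀ X → t (b * X) ≡ t X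
  t-aligned X = trans (cong t (sym (+-identityʳ (b * X)))) (t-block X 0<b)

  t-offset : ∀ p y {j} → j < b → t (b * p + (b * y + j)) ≡ iter σ j (t (p + y))
  t-offset p y {j} j<b = trans (cong t index≡) (t-block (p + y) j<b)
    where
    index≡ : b * p + (b * y + j) ≡ b * (p + y) + j
    index≡ = solve (b ∷ p ∷ y ∷ j ∷ [])

  t-step-across : ∀ X c {s} → suc s < b → t (b * X + suc s + b * c) ≡ σ (t (b * X + s + b * c))
  t-step-across X c {s} 1+s<b = begin
    t (b * X + suc s + b * c)    ≡⟨ cong t (index≡ (suc s)) ⟩
    t (b * (X + c) + suc s)      ≡⟨ t-step (X + c) 1+s<b ⟩
    σ (t (b * (X + c) + s))      ≡⟨ cong (σ ∘ t) (sym (index≡ s)) ⟩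
    σ (t (b * X + s + b * c))    ∎
    where
    open ≡-Reasoning
    index≡ : ∀ j → b * X + j + b * c ≡ b * (X + c) + j
    index≡ j = solve (b ∷ X ∷ j ∷ c ∷ [])

  μ-window : ∀ q L → μ b σ (window t q L) ≡ window t (b * q) (b * L)
  μ-window q L = nth-ext (t 0) _ _ length≡ λ x x< → pointwise x (subst (x <_) length≡ x<)
    where
    length≡ : length (μ b σ (window t q L)) ≡ length (window t (b * q) (b * L))
    length≡ = begin
      length (μ b σ (window t q L))          ≡⟨ length-μ (window t q L) ⟩
      b * length (window t q L)              ≡⟨ cong (b *_) (length-window q L) ⟩
      b * L                                  ≡⟨ sym (length-window (b * q) (b * L)) ⟩
      length (window t (b * q) (b * L))      ∎
      where open ≡-Reasoning
    pointwise : ∀ x → x < length (window t (b * q) (b * L)) →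
                nth (t 0) (μ b σ (window t q L)) x ≡ nth (t 0) (window t (b * q) (b * L)) x
    pointwise x x< with blockPosition b x
    ... | at y j j<b = begin
      nth (t 0) (μ b σ (window t q L)) (b * y + j)  ≡⟨ nth-μ (t 0) (window t q L)
                                                          (subst (y <_) (sym (length-window q L)) y<L) j<b ⟩
      iter σ j (nth (t 0) (window t q L) y)         ≡⟨ cong (iter σ j) (nth-window q L y<L) ⟩
      iter σ j (t (q + y))                          ≡⟨ sym (t-offset q y j<b) ⟩
      t (b * q + (b * y + j))                       ≡⟨ sym (nth-window (b * q) (b * L) x<bL) ⟩
      nth (t 0) (window t (b * q) (b * L)) (b * y + j) ∎
      where
      open ≡-Reasoning
      x<bL : b * y + j < b * L
      x<bL = subst (b * y + j <_) (length-window (b * q) (b * L)) x<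
      y<L : y < L
      y<L = b*q+j<b*L⇒q<L b x<bL

  periodic-μ : ∀ {p ℓ k} → Periodic p ℓ k → Periodic (b * p) (b * ℓ) (b * k)
  periodic-μ {p} {ℓ} {k} per x lt with blockPosition b x
  ... | at y j j<b = begin
    t (b * p + (b * y + j) + b * ℓ)   ≡⟨ cong t index≡ ⟩
    t (b * p + (b * (y + ℓ) + j))     ≡⟨ t-offset p (y + ℓ) j<b ⟩
    iter σ j (t (p + (y + ℓ)))        ≡⟨ cong (iter σ j ∘ t) (sym (+-assoc p y ℓ)) ⟩
    iter σ j (t (p + y + ℓ))          ≡⟨ cong (iter σ j) (per y y+ℓ<k) ⟩
    iter σ j (t (p + y))              ≡⟨ sym (t-offset p y j<b) ⟩
    t (b * p + (b * y + j))           ∎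
    where
    open ≡-Reasoning
    index≡ : b * p + (b * y + j) + b * ℓ ≡ b * p + (b * (y + ℓ) + j)
    index≡ = solve (b ∷ p ∷ y ∷ j ∷ ℓ ∷ [])
    shifted≡ : b * y + j + b * ℓ ≡ b * (y + ℓ) + j
    shifted≡ = solve (b ∷ y ∷ j ∷ ℓ ∷ [])
    y+ℓ<k : y + ℓ < k
    y+ℓ<k = b*q+j<b*L⇒q<L b (subst (_< b * k) shifted≡ lt)

  periodic-μ⁻¹ : ∀ {q c n} → Periodic (b * q) (b * c) (b * n) → Periodic q c n
  periodic-μ⁻¹ {q} {c} {n} per j j+c<n = begin
    t (q + j + c)                ≡⟨ sym (t-aligned (q + j + c)) ⟩
    t (b * (q + j + c))          ≡⟨ cong t index≡ ⟩
    t (b * q + b * j + b * c)    ≡⟨ per (b * j) (subst (_< b * n) (*-distribˡ-+ b j c) (*-monoʳ-< b j+c<n)) ⟩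
    t (b * q + b * j)            ≡⟨ cong t (sym (*-distribˡ-+ b q j)) ⟩
    t (b * (q + j))              ≡⟨ t-aligned (q + j) ⟩
    t (q + j)                    ∎
    where
    open ≡-Reasoning
    index≡ : b * (q + j + c) ≡ b * q + b * j + b * c
    index≡ = solve (b ∷ q ∷ j ∷ c ∷ [])

  powerAt-μ : ∀ {v p k} → PowerAt v p k → PowerAt (μ b σ v) (b * p) (b * k)
  powerAt-μ {v} {p} {k} pw = record
    { agrees   = agrees′
    ; periodic = subst (λ L → Periodic (b * p) L (b * k)) (sym (length-μ v)) (periodic-μ (periodic pw)) }
    where
    agrees′ : ∀ {x} → x < b * k → x < length (μ b σ v) → nth (t 0) (μ b σ v) x ≡ t (b * p + x)
    agrees′ {x} x<bk x<μv with blockPosition b x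
    ... | at y j j<b = begin
      nth (t 0) (μ b σ v) (b * y + j)  ≡⟨ nth-μ (t 0) v y<v j<b ⟩
      iter σ j (nth (t 0) v y)         ≡⟨ cong (iter σ j) (agrees pw (b*q+j<b*L⇒q<L b x<bk) y<v) ⟩
      iter σ j (t (p + y))             ≡⟨ sym (t-offset p y j<b) ⟩
      t (b * p + (b * y + j))          ∎
      where
      open ≡-Reasoning
      y<v : y < length v
      y<v = b*q+j<b*L⇒q<L b (subst (b * y + j <_) (length-μ v) x<μv)

  nonEmpty-μ : ∀ {v} → NonEmpty v → NonEmpty (μ b σ v)
  nonEmpty-μ {v} nv = subst (1 ≤_) (sym (length-μ v)) (≤-trans nv (m≤n*m (length v) b))

  powFactor-μ : ∀ {v k} → NonEmpty v → PowFactor t v k → PowFactor t (μ b σ v) (b * k)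
  powFactor-μ {v} {k} nv pv@(1≤k , _) =
    let (_ , pw) = powFactor⇒powerAt nv pv in
    powerAt⇒powFactor (nonEmpty-μ {v} nv) (≤-trans 1≤k (m≤n*m k b)) (powerAt-μ pw)

  μ-critical : ∀ {w} → IsCritical t w → IsCritical t (μ b σ w)
  μ-critical {w} (nw , (p , w≡) , n , (pfw , _) , bound) =
    critical (nonEmpty-μ {w} nw) (b * p , μw≡) (powFactor-μ {w} nw pfw)
      (exponentBound-scaleUp b {w} {μ b σ w} (length-μ w) bound)
    where
    μw≡ : μ b σ w ≡ window t (b * p) (length (μ b σ w))
    μw≡ = begin
      μ b σ w                              ≡⟨ cong (μ b σ) w≡ ⟩
      μ b σ (window t p (length w))        ≡⟨ μ-window p (length w) ⟩
      window t (b * p) (b * length w)      ≡⟨ cong (window t (b * p)) (sym (length-μ w)) ⟩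
      window t (b * p) (length (μ b σ w))  ∎
      where open ≡-Reasoning

  1+[b∸1]≡b : 1 + (b ∸ 1) ≡ b
  1+[b∸1]≡b = m+[n∸m]≡n 0<b

  initialBlock : Word m
  initialBlock = window t 1 (b ∸ 1)

  nonEmpty-initialBlock : NonEmpty initialBlock
  nonEmpty-initialBlock = subst (1 ≤_) (sym (length-window 1 (b ∸ 1))) (m<n⇒0<n∸m 2≤b)

  powFactor-initialBlock : PowFactor t initialBlock b
  powFactor-initialBlock =
    powerAt⇒powFactor nonEmpty-initialBlock 0<b (periodic⇒powerAt {1} {b ∸ 1} periodic-1-b)
    where
    periodic-1-b : Periodic 1 (b ∸ 1) b
    periodic-1-b zero    _  = trans (cong t 1+[b∸1]≡b) (trans (cong t (sym (*-identityʳ b))) (t-aligned 1))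
    periodic-1-b (suc j) lt = ⊥-elim (<⇒≱ lt (begin
      b                  ≡⟨ sym 1+[b∸1]≡b ⟩
      1 + (b ∸ 1)        ≤⟨ +-monoˡ-≤ (b ∸ 1) (s≤s z≤n) ⟩
      suc j + (b ∸ 1)    ∎))
      where open ≤-Reasoning

  length<exponent : ∀ {w n} → NonEmpty w → ExponentBound w n → length w < n
  length<exponent {w} {n} nw bound = ≰⇒> λ n≤ℓ → <⇒≱ ℓ[b∸1]<bℓ (begin
    b * ℓ                     ≤⟨ bound initialBlock b nonEmpty-initialBlock (window-factor 1 (b ∸ 1))
                                   powFactor-initialBlock ⟩
    n * length initialBlock   ≡⟨ cong (n *_) (length-window 1 (b ∸ 1)) ⟩
    n * (b ∸ 1)               ≤⟨ *-monoˡ-≤ (b ∸ 1) n≤ℓ ⟩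
    ℓ * (b ∸ 1)               ∎)
    where
    open ≤-Reasoning
    ℓ : ℕ
    ℓ = length w
    ℓ[b∸1]<bℓ : ℓ * (b ∸ 1) < b * ℓ
    ℓ[b∸1]<bℓ = begin-strict
      ℓ * (b ∸ 1)        <⟨ m<n+m (ℓ * (b ∸ 1)) nw ⟩
      ℓ + ℓ * (b ∸ 1)    ≡⟨ sym (*-suc ℓ (b ∸ 1)) ⟩
      ℓ * (1 + (b ∸ 1))  ≡⟨ cong (ℓ *_) 1+[b∸1]≡b ⟩
      ℓ * b              ≡⟨ *-comm ℓ b ⟩
      b * ℓ              ∎

  misaligned-power : Injective _≡_ _≡_ σ → ∀ {w n q r c} → NonEmpty w → length w ≡ b * c → length w < n →
                     suc r < b → ExponentBound w n → ¬ PowerAt w (b * q + suc r) n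
  misaligned-power σ-injective {w} {n} {q} {r} {c} nw ℓ≡bc ℓ<n 1+r<b bound pw =
    1+n≰n (exponentBound⇒≤ {w} bound nv (window-factor p ℓ) (length-window p ℓ)
            (powerAt⇒powFactor nv (s≤s z≤n) (periodic⇒powerAt {p} {ℓ} longer)))
    where
    ℓ : ℕ
    ℓ = length w
    p : ℕ
    p = b * q + r
    nv : NonEmpty (window t p ℓ)
    nv = subst (1 ≤_) (sym (length-window p ℓ)) nw
    edge : t (p + ℓ) ≡ t p
    edge = σ-injective (begin
      σ (t (p + ℓ))                  ≡⟨ cong (λ L → σ (t (p + L))) ℓ≡bc ⟩
      σ (t (b * q + r + b * c))      ≡⟨ sym (t-step-across q c 1+r<b) ⟩
      t (b * q + suc r + b * c)      ≡⟨ cong (λ L → t (b * q + suc r + L)) (sym ℓ≡bc) ⟩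
      t (b * q + suc r + ℓ)          ≡⟨ cong (λ x → t (x + ℓ)) (sym (+-identityʳ (b * q + suc r))) ⟩
      t (b * q + suc r + 0 + ℓ)      ≡⟨ periodic pw 0 ℓ<n ⟩
      t (b * q + suc r + 0)          ≡⟨ cong t (+-identityʳ (b * q + suc r)) ⟩
      t (b * q + suc r)              ≡⟨ t-step q 1+r<b ⟩
      σ (t p)                        ∎)
      where open ≡-Reasoning
    longer : Periodic p ℓ (suc n)
    longer = periodic-extendˡ {p} {ℓ} {n} edge
      (subst (λ x → Periodic x ℓ n) (+-suc (b * q) r) (periodic pw))

  powerAt-extend-unaligned : ∀ {w q n₁ s c} → length w ≡ b * c → length w < b * n₁ + suc s → suc s < b →
                             PowerAt w (b * q) (b * n₁ + suc s) → PowerAt w (b * q) (suc (b * n₁ + suc s))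
  powerAt-extend-unaligned {w} {q} {n₁} {s} {c} ℓ≡bc ℓ<n 1+s<b pw with offset c n₁
  ... | inside n₁<c = ⊥-elim (<⇒≱ ℓ<n (begin
    b * n₁ + suc s    ≤⟨ +-monoʳ-≤ (b * n₁) (<⇒≤ 1+s<b) ⟩
    b * n₁ + b        ≡⟨ trans (+-comm (b * n₁) b) (sym (*-suc b n₁)) ⟩
    b * suc n₁        ≤⟨ *-monoʳ-≤ b n₁<c ⟩
    b * c             ≡⟨ sym ℓ≡bc ⟩
    length w          ∎))
    where open ≤-Reasoning
  ... | beyond e = powerAt-extend (b * e + suc s) j+ℓ≡n edge pw
    where
    open ≡-Reasoning
    ℓ : ℕ
    ℓ = length w
    j+ℓ≡n : b * e + suc s + ℓ ≡ b * (c + e) + suc s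
    j+ℓ≡n = trans (cong (b * e + suc s +_) ℓ≡bc) (solve (b ∷ e ∷ s ∷ c ∷ []))
    1+j+ℓ≡n : suc (b * e + s + ℓ) ≡ b * (c + e) + suc s
    1+j+ℓ≡n = trans (cong (_+ ℓ) (sym (+-suc (b * e) s))) j+ℓ≡n
    within : ∀ i → b * q + (b * e + i) + ℓ ≡ b * (q + e) + i + b * c
    within i = trans (cong (b * q + (b * e + i) +_) ℓ≡bc) (solve (b ∷ q ∷ e ∷ i ∷ c ∷ []))
    start : ∀ i → b * q + (b * e + i) ≡ b * (q + e) + i
    start i = solve (b ∷ q ∷ e ∷ i ∷ [])
    edge : t (b * q + (b * e + suc s) + ℓ) ≡ t (b * q + (b * e + suc s))
    edge = begin
      t (b * q + (b * e + suc s) + ℓ)   ≡⟨ cong t (within (suc s)) ⟩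
      t (b * (q + e) + suc s + b * c)   ≡⟨ t-step-across (q + e) c 1+s<b ⟩
      σ (t (b * (q + e) + s + b * c))   ≡⟨ cong (σ ∘ t) (sym (within s)) ⟩
      σ (t (b * q + (b * e + s) + ℓ))   ≡⟨ cong σ (periodic pw (b * e + s) (≤-reflexive 1+j+ℓ≡n)) ⟩
      σ (t (b * q + (b * e + s)))       ≡⟨ cong (σ ∘ t) (start s) ⟩
      σ (t (b * (q + e) + s))           ≡⟨ sym (t-step (q + e) 1+s<b) ⟩
      t (b * (q + e) + suc s)           ≡⟨ cong t (sym (start (suc s))) ⟩
      t (b * q + (b * e + suc s))       ∎

  start-aligned : Injective _≡_ _≡_ σ → ∀ {w n p c} → NonEmpty w → length w ≡ b * c → length w < n →
                  ExponentBound w n → PowerAt w p n → ∃ λ q → p ≡ b * q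
  start-aligned σ-injective {p = p} nw ℓ≡bc ℓ<n bound pw with blockPosition b p
  ... | at q zero    _     = q , +-identityʳ (b * q)
  ... | at q (suc r) 1+r<b = ⊥-elim (misaligned-power σ-injective nw ℓ≡bc ℓ<n 1+r<b bound pw)

  exponent-aligned : ∀ {w n q c} → NonEmpty w → length w ≡ b * c → length w < n →
                     (∀ k → PowFactor t w k → k ≤ n) → PowerAt w (b * q) n → ∃ λ n₁ → n ≡ b * n₁
  exponent-aligned {w} {n} {q} nw ℓ≡bc ℓ<n maximal pw with blockPosition b n
  ... | at n₁ zero    _     = n₁ , +-identityʳ (b * n₁)
  ... | at n₁ (suc s) 1+s<b = ⊥-elim (1+n≰n (maximal _ (powerAt⇒powFactor nw (s≤s z≤n) longer)))
    where
    longer : PowerAt w (b * q) (suc (b * n₁ + suc s))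
    longer = powerAt-extend-unaligned ℓ≡bc ℓ<n 1+s<b pw

  aligned-critical-power : ∀ {w q n₁ c} → NonEmpty w → length w ≡ b * c → length w < b * n₁ →
                           ExponentBound w (b * n₁) → PowerAt w (b * q) (b * n₁) →
                           w ≡ μ b σ (window t q c) × IsCritical t (window t q c)
  aligned-critical-power {w} {q} {n₁} {c} nw ℓ≡bc ℓ<n bound pw =
    w≡μu , critical nu (window-factor q c) pu (exponentBound-scaleDown b {u} {w} ℓ≡b|u| bound)
    where
    u : Word m
    u = window t q c
    ℓ≡b|u| : length w ≡ b * length u
    ℓ≡b|u| = trans ℓ≡bc (cong (b *_) (sym (length-window q c)))
    w≡μu : w ≡ μ b σ u
    w≡μu = begin
      w                            ≡⟨ powerAt⇒window (<⇒≤ ℓ<n) pw ⟩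
      window t (b * q) (length w)  ≡⟨ cong (window t (b * q)) ℓ≡bc ⟩
      window t (b * q) (b * c)     ≡⟨ sym (μ-window q c) ⟩
      μ b σ u                      ∎
      where open ≡-Reasoning
    nu : NonEmpty u
    nu = subst (1 ≤_) (sym (length-window q c)) (1≤m*n⇒1≤n b (subst (1 ≤_) ℓ≡bc nw))
    per : Periodic q c n₁
    per = periodic-μ⁻¹ (subst (λ L → Periodic (b * q) L (b * n₁)) ℓ≡bc (periodic pw))
    pu : PowFactor t u n₁
    pu = powerAt⇒powFactor nu (1≤m*n⇒1≤n b (m<n⇒0<n ℓ<n)) (periodic⇒powerAt {q} {c} per)

  power-desubstitution : Injective _≡_ _≡_ σ → ∀ {w n p c} → NonEmpty w → length w ≡ b * c → length w < n →
                         (∀ k → PowFactor t w k → k ≤ n) → ExponentBound w n → PowerAt w p n →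
                         ∃ λ u → w ≡ μ b σ u × IsCritical t u
  power-desubstitution σ-injective {c = c} nw ℓ≡bc ℓ<n maximal bound pw
    with start-aligned σ-injective nw ℓ≡bc ℓ<n bound pw
  ... | q , refl with exponent-aligned nw ℓ≡bc ℓ<n maximal pw
  ... | n₁ , refl = window t q c , aligned-critical-power nw ℓ≡bc ℓ<n bound pw

  critical-desubstitution : Injective _≡_ _≡_ σ → ∀ {w} → IsCritical t w → b ∣ length w →
                            ∃ λ u → w ≡ μ b σ u × IsCritical t u
  critical-desubstitution σ-injective {w} (nw , _ , _ , (pfw , maximal) , bound) (divides c ℓ≡cb) =
    let (_ , pw) = powFactor⇒powerAt nw pfw in
    power-desubstitution σ-injective nw (trans ℓ≡cb (*-comm c b)) (length<exponent {w} nw bound)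
      maximal bound pw

lemma5p1 : (b m : ℕ) → 2 ≤ b → 1 ≤ m → ¬ (m ∣ (b ∸ 1)) →
    (σ : Fin m → Fin m) → IsCyclicPerm σ → (ᾱ : Fin m) →
    (w : Word m) → IsCritical (tm b σ ᾱ) w →
    IsCritical (tm b σ ᾱ) (μ b σ w) ×
    (b ∣ length w →
      Σ (Word m) λ u → w ≡ μ b σ u × (∀ u′ → w ≡ μ b σ u′ → u′ ≡ u) × IsCritical (tm b σ ᾱ) u)
lemma5p1 b m 2≤b _ _ σ (σ-injective , _) ᾱ w w-critical =
  μ-critical w-critical , λ b∣ℓ →
    let (u , w≡μu , u-critical) = critical-desubstitution σ-injective w-critical b∣ℓ in
    u , w≡μu , (λ u′ w≡μu′ → μ-injective 0<b (trans (sym w≡μu′) w≡μu)) , u-critical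
  where open ThueMorse b 2≤b σ ᾱ
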